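{- Let $k\geq 1$, $n\geq 0$, and let $M=(\mu_1,\dots,\mu_k)$ be an operation array of length $n+1$ and order $k$ with semitrace $T=(\alpha_1,\dots,\alpha_{k+1})$. Then $M$ is a sorting plan if and only if both of the following hold: (i) there is no pair of distinct $a,b\in[n]$ such that $T_{a,b}$ is bounded and forbidden; (ii) for each $r\in\{2,\dots,k\}$, the word $\mu_r$ contains no three consecutive letters $\mathtt{d}$ (equivalently, every block of $\alpha_r$ with respect to $\mu_r$ has size at most $3$).
   Context: An operation sequence of length $n+1$ is a word $c_1\dots c_{n+1}$ over $\{\mathtt{a},\mathtt{d}\}$ with $c_1=c_{n+1}=\mathtt{a}$; an occurrence $c_m=\mathtt{a}$ is called a bar, located between positions $m-1$ and $m$ of a permutation of $[n]$. For a permutation $\pi=\pi(1)\dots\pi(n)$ and operation sequence $\mu$ with $\mathtt{a}$'s at indices $i_1<\dots<i_t$, the blocks of $\pi$ w.r.t. $\mu$ are the contiguous factors occupying positions $i_j,\dots,i_{j+1}-1$, and $\mathrm{rev}(\pi,\mu)$ is obtained by reversing each block. For a permutation $\pi$ of $[n]$, $w(\pi)=c_1\dots c_{n+1}$ with $c_1=c_{n+1}=\mathtt{a}$ and, for $2\le m\le n$, $c_m=\mathtt{a}$ if $\pi(m-1)<\pi(m)$ and $c_m=\mathtt{d}$ otherwise. An operation array of length $n+1$ and order $k$ is a $k$-tuple $M=(\mu_1,\dots,\mu_k)$ of operation sequences of length $n+1$ (row $r$ is $\mu_r$). Its semitrace is the tuple $(\alpha_1,\dots,\alpha_{k+1})$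 of permutations of $[n]$ with $\alpha_{k+1}$ the identity and $\alpha_i=\mathrm{rev}(\alpha_{i+1},\mu_i)$ for $i=k,\dots,1$. $M$ is a sorting plan if $w(\alpha_i)=\mu_i$ for all $i=1,\dots,k$. For distinct $a,b\in[n]$ and $i\in[k]$, say $a,b$ violate row $i$ if they occupy adjacent positions $m,m+1$ of $\alpha_i$ (in either order) and either $\alpha_i(m)>\alpha_i(m+1)$ and the $(m+1)$-st letter of $\mu_i$ is $\mathtt{a}$, or $\alpha_i(m)<\alpha_i(m+1)$ and that letter is $\mathtt{d}$. A segment of $M$ is the array formed by columns $i,i+1,\dots,j$ ($1\le i\le j\le n+1$) of $M$ (column $m$ consisting of the $m$-th letters of $\mu_1,\dots,\mu_k$); its length is $j-i+1$. A block of $\alpha_r$ w.r.t. $\mu_r$ occupying positions $p,\dots,q$ (so bars at $p$ and $q+1$) is contained in the segment of columns $i..j$ if $i\le p$ and $q+1\le j$. $T_{a,b}$ is the smallest segment of $M$ containing every block of $\alpha_r$ w.r.t. $\mu_r$, for $r=2,\dots,k$, that contains $a$ or $b$. $T_{a,b}$ (with columns $i..j$) is bounded if for every $r\in\{2,\dots,k\}$ the letters of $\mu_r$ at indices $i,\dots,j$ contain no three consecutive $\mathtt{d}$'s. $T_{a,b}$ is forbidden if (F0) $a,b$ violate row $i$ for some $2\le i\le k$; or (F1) $a,b$ occupy adjacent positions $m,m+1$ of $\alpha_2$ with $\alpha_2(m)>\alpha_2(m+1)$ and the $(m+1)$-st letter of $\mu_1$ is $\mathtt{d}$; or (F2) in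 $\alpha_2$ the larger of $a,b$ is at position $p$ and the smaller at position $q$ with $p<q$, the $p$-th and $(q+1)$-st letters of $\mu_1$ are $\mathtt{a}$, and exactly one of the letters of $\mu_1$ at indices $p+1,\dots,q$ is $\mathtt{a}$. (Here $\alpha_2$ is the identity when $k=1$.) -}

module Defs where

open import Data.Nat using (ℕ; zero; suc; _+_; _∸_; _≤_; _<_; _>_; _⊔_; _⊓_)
open import Data.Nat.Properties using (_≟_; _<?_)
open import Data.Fin using (Fin; toℕ)
open import Data.Vec using (Vec; []; _∷_; tabulate; replicate)
open import Data.Vec.Relation.Unary.All using (All)
open import Data.Product using (Σ; ∃; _×_; _,_)
open import Data.Sum using (_⊎_)
open import Relation.Nullary using (¬_; yes; no)
open import Relation.Binary.PropositionalEquality using (_≡_; _≢_)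

-- Letters of operation sequences: 𝚊 (bar / ascent) and 𝚍.
data Letter : Set where
  𝚊 𝚍 : Letter

-- 1-based lookup into a vector, with a default outside the range 1..length.
-- (Every use below is guarded by range conditions, so the default is never
-- relevant for the meaning.)
at : ∀ {ℓ} {A : Set ℓ} {n} → A → Vec A n → ℕ → A
at def v zero = def
at def [] (suc m) = def
at def (x ∷ xs) (suc zero) = x
at def (x ∷ xs) (suc (suc m)) = at def xs (suc m)

Word : ℕ → Set
Word n = Vec Letter (suc n)

_⟨_⟩ : ∀ {n} → Word n → ℕ → Letter
μ ⟨ m ⟩ = at 𝚊 μ m

-- Permutations of [n] = {1..n} as vectors of values; π [ m ] = π(m), 1-based.
Perm : ℕ → Set
Perm n = Vec ℕ n

_[_] : ∀ {n} → Perm n → ℕ → ℕ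
π [ m ] = at 0 π m

idPerm : (n : ℕ) → Perm n
idPerm n = tabulate (λ i → suc (toℕ i))

IsOpSeq : ∀ {n} → Word n → Set
IsOpSeq {n} μ = (μ ⟨ 1 ⟩ ≡ 𝚊) × (μ ⟨ suc n ⟩ ≡ 𝚊)

OpArray : ℕ → ℕ → Set
OpArray k n = Vec (Word n) k

IsOpArray : ∀ {k n} → OpArray k n → Set
IsOpArray M = All IsOpSeq M

row : ∀ {k n} → OpArray k n → ℕ → Word n
row M r = at (replicate _ 𝚊) M r

bstart : ∀ {n} → Word n → ℕ → ℕ
bstart μ zero = zero
bstart μ (suc m) with μ ⟨ suc m ⟩
... | 𝚊 = suc m
... | 𝚍 = bstart μ m

bendF : ∀ {n} → ℕ → Word n → ℕ → ℕ
bendF zero μ m = m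
bendF (suc f) μ m with μ ⟨ suc m ⟩
... | 𝚊 = m
... | 𝚍 = bendF f μ (suc m)

bend : ∀ {n} → Word n → ℕ → ℕ
bend {n} μ m = bendF n μ m

rev : ∀ {n} → Perm n → Word n → Perm n
rev π μ = tabulate (λ i → π [ bstart μ (suc (toℕ i)) + bend μ (suc (toℕ i)) ∸ suc (toℕ i) ])

semitraceV : ∀ {k n} → OpArray k n → Vec (Perm n) (suc k)
semitraceV {n = n} [] = idPerm n ∷ []
semitraceV (μ ∷ M) with semitraceV M
... | α ∷ T = rev α μ ∷ α ∷ T

alpha : ∀ {k n} → OpArray k n → ℕ → Perm n
alpha {n = n} M i = at (idPerm n) (semitraceV M) i

wLetter : ∀ {n} → Perm n → ℕ → Letter
wLetter {n} π m with m ≟ 1 | m ≟ suc n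
... | yes _ | _ = 𝚊
... | no _ | yes _ = 𝚊
... | no _ | no _ with π [ m ∸ 1 ] <? π [ m ]
...   | yes _ = 𝚊
...   | no _ = 𝚍

w : ∀ {n} → Perm n → Word n
w π = tabulate (λ i → wLetter π (suc (toℕ i)))

SortingPlan : ∀ {k n} → OpArray k n → Set
SortingPlan {k} M = ∀ i → 1 ≤ i → i ≤ k → w (alpha M i) ≡ row M i

AdjAt : ∀ {n} → Perm n → ℕ → ℕ → ℕ → Set
AdjAt π a b m = ((π [ m ] ≡ a) × (π [ suc m ] ≡ b)) ⊎ ((π [ m ] ≡ b) × (π [ suc m ] ≡ a))

Violate : ∀ {k n} → OpArray k n → ℕ → ℕ → ℕ → Set
Violate {n = n} M a b i = ∃ λ m → (1 ≤ m) × (suc m ≤ n) × AdjAt (alpha M i) a b m ×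
  (((alpha M i [ m ] > alpha M i [ suc m ]) × (row M i ⟨ suc m ⟩ ≡ 𝚊)) ⊎
   ((alpha M i [ m ] < alpha M i [ suc m ]) × (row M i ⟨ suc m ⟩ ≡ 𝚍)))

IsBlock : ∀ {n} → Word n → ℕ → ℕ → Set
IsBlock {n} μ p q = (1 ≤ p) × (p ≤ q) × (q ≤ n) × (μ ⟨ p ⟩ ≡ 𝚊) × (μ ⟨ suc q ⟩ ≡ 𝚊) ×
  (∀ m → p < m → m ≤ q → μ ⟨ m ⟩ ≡ 𝚍)

Relevant : ∀ {k n} → OpArray k n → ℕ → ℕ → ℕ → ℕ → ℕ → Set
Relevant {k} M a b r p q = (2 ≤ r) × (r ≤ k) × IsBlock (row M r) p q ×
  (∃ λ m → (p ≤ m) × (m ≤ q) × ((alpha M r [ m ] ≡ a) ⊎ (alpha M r [ m ] ≡ b)))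

IsSegment : ℕ → ℕ → ℕ → Set
IsSegment n i j = (1 ≤ i) × (i ≤ j) × (j ≤ suc n)

ContainsAll : ∀ {k n} → OpArray k n → ℕ → ℕ → ℕ → ℕ → Set
ContainsAll M a b i j = ∀ r p q → Relevant M a b r p q → (i ≤ p) × (suc q ≤ j)

IsT : ∀ {k n} → OpArray k n → ℕ → ℕ → ℕ → ℕ → Set
IsT {n = n} M a b i j = IsSegment n i j × ContainsAll M a b i j ×
  (∀ i' j' → IsSegment n i' j' → ContainsAll M a b i' j' → (i' ≤ i) × (j ≤ j'))

DDDin : ∀ {n} → Word n → ℕ → ℕ → Set
DDDin μ i j = ∃ λ m → (i ≤ m) × (m + 2 ≤ j) ×
  (μ ⟨ m ⟩ ≡ 𝚍) × (μ ⟨ suc m ⟩ ≡ 𝚍) × (μ ⟨ suc (suc m) ⟩ ≡ 𝚍)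

Bounded : ∀ {k n} → OpArray k n → ℕ → ℕ → Set
Bounded {k} M a b = ∀ i j → IsT M a b i j →
  ∀ r → 2 ≤ r → r ≤ k → ¬ DDDin (row M r) i j

F0 : ∀ {k n} → OpArray k n → ℕ → ℕ → Set
F0 {k} M a b = ∃ λ i → (2 ≤ i) × (i ≤ k) × Violate M a b i

F1 : ∀ {k n} → OpArray k n → ℕ → ℕ → Set
F1 {n = n} M a b = ∃ λ m → (1 ≤ m) × (suc m ≤ n) × AdjAt (alpha M 2) a b m ×
  (alpha M 2 [ m ] > alpha M 2 [ suc m ]) × (row M 1 ⟨ suc m ⟩ ≡ 𝚍)

F2 : ∀ {k n} → OpArray k n → ℕ → ℕ → Set
F2 {n = n} M a b = ∃ λ p → ∃ λ q → (1 ≤ p) × (p < q) × (q ≤ n) ×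
  (alpha M 2 [ p ] ≡ a ⊔ b) × (alpha M 2 [ q ] ≡ a ⊓ b) ×
  (row M 1 ⟨ p ⟩ ≡ 𝚊) × (row M 1 ⟨ suc q ⟩ ≡ 𝚊) ×
  (∃ λ m → (p < m) × (m ≤ q) × (row M 1 ⟨ m ⟩ ≡ 𝚊) ×
     (∀ m' → p < m' → m' ≤ q → row M 1 ⟨ m' ⟩ ≡ 𝚊 → m' ≡ m))

Forbidden : ∀ {k n} → OpArray k n → ℕ → ℕ → Set
Forbidden M a b = F0 M a b ⊎ F1 M a b ⊎ F2 M a b

NoBoundedForbidden : ∀ {k n} → OpArray k n → Set
NoBoundedForbidden {n = n} M = ¬ (∃ λ a → ∃ λ b → (1 ≤ a) × (a ≤ n) × (1 ≤ b) × (b ≤ n) ×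
  (a ≢ b) × Bounded M a b × Forbidden M a b)

NoDDDRows : ∀ {k n} → OpArray k n → Set
NoDDDRows {k} {n} M = ∀ r → 2 ≤ r → r ≤ k → ¬ DDDin (row M r) 1 (suc n)

-- Write α = rev(β, μ). Inside a block of μ the reversal turns every adjacent pair of β into
-- the mirrored pair of α in the opposite order, so w(α) = μ (α descends inside blocks,
-- ascends at bars) forces every descent of β to sit at a bar of μ. Hence for row 1 a
-- mismatch between α₁ and μ₁ is either a descent of α₂ inside a block of μ₁ (F1) or the
-- maximum/minimum of two consecutive blocks of μ₁ arriving in the wrong order (F2), and
-- conversely. For rows r ≥ 2 a mismatch is a violation (F0) directly, and three consecutive
-- 𝚍's in μᵣ give three consecutive descents of αᵣ whose middle pair is fixed by μᵣ₋₁ yet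
-- must become an ascent. Condition (ii) makes every T_{a,b} bounded, so (i) only has to
-- exclude the forbidden adjacent pairs.
module Submission where

open import Defs
open import Data.Nat using (ℕ; _≤_)
open import Data.Product using (_×_)
open import Function.Bundles using (_⇔_)
open import Data.Nat using (zero; suc; _+_; _∸_; _<_; _>_; _⊔_; _⊓_; z≤n; s≤s)
open import Data.Nat.Properties
open import Data.Fin using (toℕ)
open import Data.Vec using (Vec; []; _∷_; tabulate; head)
open import Data.Vec.Relation.Unary.All using (_∷_)
open import Data.Product using (∃; _,_; proj₁; proj₂)
open import Data.Sum using (_⊎_; inj₁; inj₂)
open import Data.Empty using (⊥-elim)
open import Relation.Nullary using (¬_; yes; no)
open import Relation.Binary.Definitions using (tri<; tri≈; tri>)
open import Relation.Binary.PropositionalEquality hiding ([_])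
open import Function.Bundles using (mk⇔; Equivalence)

𝚊≢𝚍 : 𝚊 ≢ 𝚍
𝚊≢𝚍 ()

≢𝚊⇒≡𝚍 : ∀ {l} → l ≢ 𝚊 → l ≡ 𝚍
≢𝚊⇒≡𝚍 {𝚊} l≢𝚊 = ⊥-elim (l≢𝚊 refl)
≢𝚊⇒≡𝚍 {𝚍} _ = refl

≢𝚍⇒≡𝚊 : ∀ {l} → l ≢ 𝚍 → l ≡ 𝚊
≢𝚍⇒≡𝚊 {𝚊} _ = refl
≢𝚍⇒≡𝚊 {𝚍} l≢𝚍 = ⊥-elim (l≢𝚍 refl)

at-tabulate : ∀ {ℓ} {A : Set ℓ} n (d : A) (f : ℕ → A) i → i < n →
  at d (tabulate {n = n} (λ j → f (toℕ j))) (suc i) ≡ f i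
at-tabulate (suc n) d f zero _ = refl
at-tabulate (suc n) d f (suc i) (s≤s i<n) = at-tabulate n d (λ x → f (suc x)) i i<n

at-ext : ∀ {ℓ} {A : Set ℓ} n (d : A) (u v : Vec A n) →
  (∀ i → i < n → at d u (suc i) ≡ at d v (suc i)) → u ≡ v
at-ext zero d [] [] _ = refl
at-ext (suc n) d (x ∷ u) (y ∷ v) u≗v =
  cong₂ _∷_ (u≗v 0 (s≤s z≤n)) (at-ext n d u v (λ i i<n → u≗v (suc i) (s≤s i<n)))

p≤p+q∸x : ∀ p q x → x ≤ q → p ≤ p + q ∸ x
p≤p+q∸x p q x x≤q = subst (p ≤_) (sym (+-∸-assoc p x≤q)) (m≤m+n p (q ∸ x))

p+q∸x≤q : ∀ p q x → p ≤ x → x ≤ q → p + q ∸ x ≤ q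
p+q∸x≤q p q x p≤x x≤q = subst (_≤ q) (sym (+-∸-assoc p x≤q))
  (≤-trans (+-monoˡ-≤ (q ∸ x) p≤x) (≤-reflexive (m+[n∸m]≡n x≤q)))

p+q∸[p+q∸x]≡x : ∀ p q x → x ≤ q → p + q ∸ (p + q ∸ x) ≡ x
p+q∸[p+q∸x]≡x p q x x≤q = m∸[m∸n]≡n (≤-trans x≤q (m≤n+m q p))

suc[p+q∸suc[x]]≡p+q∸x : ∀ p q x → suc x ≤ q → suc (p + q ∸ suc x) ≡ p + q ∸ x
suc[p+q∸suc[x]]≡p+q∸x p q x x<q = begin
  suc (p + q ∸ suc x)   ≡⟨ cong suc (+-∸-assoc p x<q) ⟩
  suc (p + (q ∸ suc x)) ≡⟨ sym (+-suc p _) ⟩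
  p + suc (q ∸ suc x)   ≡⟨ cong (p +_) (sym (+-∸-assoc 1 x<q)) ⟩
  p + (q ∸ x)           ≡⟨ sym (+-∸-assoc p (≤-trans (n≤1+n x) x<q)) ⟩
  p + q ∸ x             ∎
  where open ≡-Reasoning

-- Blocks and their reversal

bstart-unique : ∀ {n} (μ : Word n) p z → μ ⟨ p ⟩ ≡ 𝚊 →
  (∀ m → p < m → m ≤ z → μ ⟨ m ⟩ ≡ 𝚍) → p ≤ z → bstart μ z ≡ p
bstart-unique μ .zero zero _ _ z≤n = refl
bstart-unique μ p (suc z) bar inner p≤z with μ ⟨ suc z ⟩ in eq | m≤n⇒m<n∨m≡n p≤z
... | 𝚊 | inj₁ p<z = ⊥-elim (𝚊≢𝚍 (trans (sym eq) (inner (suc z) p<z ≤-refl)))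
... | 𝚊 | inj₂ p≡z = sym p≡z
... | 𝚍 | inj₁ p<z =
  bstart-unique μ p z bar (λ m p<m m≤z → inner m p<m (m≤n⇒m≤1+n m≤z)) (≤-pred p<z)
... | 𝚍 | inj₂ refl = ⊥-elim (𝚊≢𝚍 (trans (sym bar) eq))

bendF-unique : ∀ {n} (μ : Word n) q f z → μ ⟨ suc q ⟩ ≡ 𝚊 →
  (∀ m → z < m → m ≤ q → μ ⟨ m ⟩ ≡ 𝚍) → z ≤ q → q ∸ z ≤ f → bendF f μ z ≡ q
bendF-unique μ q zero z _ _ z≤q q∸z≤0 = ≤-antisym z≤q (m∸n≡0⇒m≤n (n≤0⇒n≡0 q∸z≤0))
bendF-unique μ q (suc f) z bar inner z≤q q∸z≤f with μ ⟨ suc z ⟩ in eq | m≤n⇒m<n∨m≡n z≤q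
... | 𝚊 | inj₁ z<q = ⊥-elim (𝚊≢𝚍 (trans (sym eq) (inner (suc z) ≤-refl z<q)))
... | 𝚊 | inj₂ z≡q = z≡q
... | 𝚍 | inj₁ z<q =
  bendF-unique μ q f (suc z) bar (λ m z<m m≤q → inner m (<-trans (n<1+n z) z<m) m≤q) z<q
    (subst (_≤ f) (pred[m∸n]≡m∸[1+n] q z) (pred-mono-≤ q∸z≤f))
... | 𝚍 | inj₂ refl = ⊥-elim (𝚊≢𝚍 (trans (sym bar) eq))

bstart-spec : ∀ {n} (μ : Word n) z → μ ⟨ 1 ⟩ ≡ 𝚊 → 1 ≤ z →
  (1 ≤ bstart μ z) × (bstart μ z ≤ z) × (μ ⟨ bstart μ z ⟩ ≡ 𝚊) ×
  (∀ m → bstart μ z < m → m ≤ z → μ ⟨ m ⟩ ≡ 𝚍)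
bstart-spec μ (suc z) first _ with μ ⟨ suc z ⟩ in eq
... | 𝚊 = s≤s z≤n , ≤-refl , eq , λ m z<m m≤z → ⊥-elim (<⇒≱ z<m m≤z)
bstart-spec μ (suc zero) first _ | 𝚍 = ⊥-elim (𝚊≢𝚍 (trans (sym first) eq))
bstart-spec μ (suc (suc z)) first _ | 𝚍 with bstart-spec μ (suc z) first (s≤s z≤n)
... | 1≤s , s≤z , bar , inner = 1≤s , m≤n⇒m≤1+n s≤z , bar , inner′
  where
  inner′ : ∀ m → bstart μ (suc z) < m → m ≤ suc (suc z) → μ ⟨ m ⟩ ≡ 𝚍
  inner′ m s<m m≤z with m≤n⇒m<n∨m≡n m≤z
  ... | inj₁ m<z = inner m s<m (≤-pred m<z)
  ... | inj₂ refl = eq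

bendF-spec : ∀ {n} (μ : Word n) f z → μ ⟨ suc n ⟩ ≡ 𝚊 → z ≤ n → n ≤ z + f →
  (z ≤ bendF f μ z) × (bendF f μ z ≤ n) × (μ ⟨ suc (bendF f μ z) ⟩ ≡ 𝚊) ×
  (∀ m → z < m → m ≤ bendF f μ z → μ ⟨ m ⟩ ≡ 𝚍)
bendF-spec {n} μ zero z last z≤len n≤z+0 with ≤-antisym z≤len (subst (n ≤_) (+-identityʳ z) n≤z+0)
... | refl = ≤-refl , z≤len , last , λ m z<m m≤z → ⊥-elim (<⇒≱ z<m m≤z)
bendF-spec {n} μ (suc f) z last z≤len n≤z+f with μ ⟨ suc z ⟩ in eq
... | 𝚊 = ≤-refl , z≤len , eq , λ m z<m m≤z → ⊥-elim (<⇒≱ z<m m≤z)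
... | 𝚍 with m≤n⇒m<n∨m≡n z≤len
...   | inj₂ refl = ⊥-elim (𝚊≢𝚍 (trans (sym last) eq))
...   | inj₁ z<n with bendF-spec μ f (suc z) last z<n (subst (n ≤_) (+-suc z f) n≤z+f)
...     | z<e , e≤n , bar , inner = ≤-trans (n≤1+n z) z<e , e≤n , bar , inner′
  where
  inner′ : ∀ m → z < m → m ≤ bendF f μ (suc z) → μ ⟨ m ⟩ ≡ 𝚍
  inner′ m z<m m≤e with m≤n⇒m<n∨m≡n z<m
  ... | inj₁ 1+z<m = inner m 1+z<m m≤e
  ... | inj₂ refl = eq

block-around : ∀ {n} (μ : Word n) m → IsOpSeq μ → 1 ≤ m → m ≤ n →
  IsBlock μ (bstart μ m) (bend μ m) × (bstart μ m ≤ m) × (m ≤ bend μ m)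
block-around {n} μ m (first , last) 1≤m m≤n
  with bstart-spec μ m first 1≤m | bendF-spec μ n m last m≤n (m≤n+m n m)
... | 1≤s , s≤m , s-bar , s-inner | m≤e , e≤n , e-bar , e-inner =
  (1≤s , ≤-trans s≤m m≤e , e≤n , s-bar , e-bar , inner) , s≤m , m≤e
  where
  inner : ∀ x → bstart μ m < x → x ≤ bend μ m → μ ⟨ x ⟩ ≡ 𝚍
  inner x s<x x≤e with ≤-<-connex x m
  ... | inj₁ x≤m = s-inner x s<x x≤m
  ... | inj₂ m<x = e-inner x m<x x≤e

bstart-bend-block : ∀ {n} (μ : Word n) p q z → IsBlock μ p q → p ≤ z → z ≤ q →
  (bstart μ z ≡ p) × (bend μ z ≡ q)
bstart-bend-block {n} μ p q z (_ , _ , q≤n , p-bar , q-bar , inner) p≤z z≤q =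
  bstart-unique μ p z p-bar (λ m p<m m≤z → inner m p<m (≤-trans m≤z z≤q)) p≤z ,
  bendF-unique μ q n z q-bar (λ m z<m m≤q → inner m (<-≤-trans (s≤s p≤z) z<m) m≤q) z≤q
    (≤-trans (m∸n≤m q z) q≤n)

block-bar⇒end : ∀ {n} (μ : Word n) p q x → IsBlock μ p q → p ≤ x → x ≤ q →
  μ ⟨ suc x ⟩ ≡ 𝚊 → x ≡ q
block-bar⇒end μ p q x (_ , _ , _ , _ , _ , inner) p≤x x≤q bar with m≤n⇒m<n∨m≡n x≤q
... | inj₁ x<q = ⊥-elim (𝚊≢𝚍 (trans (sym bar) (inner (suc x) (s≤s p≤x) x<q)))
... | inj₂ x≡q = x≡q

block-bar⇒start : ∀ {n} (μ : Word n) p q x → IsBlock μ p q → p ≤ x → x ≤ q →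
  μ ⟨ x ⟩ ≡ 𝚊 → x ≡ p
block-bar⇒start μ p q x (_ , _ , _ , _ , _ , inner) p≤x x≤q bar with m≤n⇒m<n∨m≡n p≤x
... | inj₁ p<x = ⊥-elim (𝚊≢𝚍 (trans (sym bar) (inner x p<x x≤q)))
... | inj₂ p≡x = sym p≡x

block-ending-at : ∀ {n} (μ : Word n) m → IsOpSeq μ → 1 ≤ m → m ≤ n → μ ⟨ suc m ⟩ ≡ 𝚊 →
  ∃ λ p → IsBlock μ p m
block-ending-at μ m os 1≤m m≤n bar with block-around μ m os 1≤m m≤n
... | B , p≤m , m≤q = bstart μ m ,
  subst (IsBlock μ (bstart μ m)) (sym (block-bar⇒end μ _ _ m B p≤m m≤q bar)) B

block-starting-at : ∀ {n} (μ : Word n) m → IsOpSeq μ → 1 ≤ m → m ≤ n → μ ⟨ m ⟩ ≡ 𝚊 →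
  ∃ λ q → IsBlock μ m q
block-starting-at μ m os 1≤m m≤n bar with block-around μ m os 1≤m m≤n
... | B , p≤m , m≤q = bend μ m ,
  subst (λ p → IsBlock μ p (bend μ m)) (sym (block-bar⇒start μ _ _ m B p≤m m≤q bar)) B

singleton-block : ∀ {n} (μ : Word n) p → 1 ≤ p → p ≤ n → μ ⟨ p ⟩ ≡ 𝚊 → μ ⟨ suc p ⟩ ≡ 𝚊 →
  IsBlock μ p p
singleton-block μ p 1≤p p≤n bar bar′ =
  1≤p , ≤-refl , p≤n , bar , bar′ , λ m p<m m≤p → ⊥-elim (<⇒≱ p<m m≤p)

reflect : ∀ {n} → Word n → ℕ → ℕ
reflect μ x = bstart μ x + bend μ x ∸ x

rev-at : ∀ {n} (π : Perm n) (μ : Word n) x → 1 ≤ x → x ≤ n → rev π μ [ x ] ≡ π [ reflect μ x ]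
rev-at {n} π μ (suc i) _ x≤n = at-tabulate n 0 (λ j → π [ reflect μ (suc j) ]) i x≤n

reflect-block : ∀ {n} (μ : Word n) p q x → IsBlock μ p q → p ≤ x → x ≤ q →
  reflect μ x ≡ p + q ∸ x
reflect-block μ p q x B p≤x x≤q with bstart-bend-block μ p q x B p≤x x≤q
... | s≡p , e≡q = cong₂ (λ s e → s + e ∸ x) s≡p e≡q

rev-block : ∀ {n} (π : Perm n) (μ : Word n) p q x → IsBlock μ p q → p ≤ x → x ≤ q →
  rev π μ [ x ] ≡ π [ p + q ∸ x ]
rev-block π μ p q x B@(1≤p , _ , q≤n , _) p≤x x≤q =
  trans (rev-at π μ x (≤-trans 1≤p p≤x) (≤-trans x≤q q≤n))
        (cong (π [_]) (reflect-block μ p q x B p≤x x≤q))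

rev-block-start : ∀ {n} (π : Perm n) (μ : Word n) p q → IsBlock μ p q → rev π μ [ p ] ≡ π [ q ]
rev-block-start π μ p q B@(_ , p≤q , _) =
  trans (rev-block π μ p q p B ≤-refl p≤q) (cong (π [_]) (m+n∸m≡n p q))

rev-block-end : ∀ {n} (π : Perm n) (μ : Word n) p q → IsBlock μ p q → rev π μ [ q ] ≡ π [ p ]
rev-block-end π μ p q B@(_ , p≤q , _) =
  trans (rev-block π μ p q q B p≤q ≤-refl) (cong (π [_]) (m+n∸n≡m p q))

-- The pair x, x+1 inside a block and its mirror image s, s+1 are exchanged by the reversal.
record InnerMirror {n} (β : Perm n) (μ : Word n) (x : ℕ) : Set where
  field
    s : ℕ
    1≤s : 1 ≤ s
    1+s≤n : suc s ≤ n
    inner-s : μ ⟨ suc s ⟩ ≡ 𝚍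
    rev-s : rev β μ [ s ] ≡ β [ suc x ]
    rev-1+s : rev β μ [ suc s ] ≡ β [ x ]
    rev-x : rev β μ [ x ] ≡ β [ suc s ]
    rev-1+x : rev β μ [ suc x ] ≡ β [ s ]

inner-mirror : ∀ {n} (β : Perm n) (μ : Word n) x → IsOpSeq μ → 1 ≤ x → suc x ≤ n →
  μ ⟨ suc x ⟩ ≡ 𝚍 → InnerMirror β μ x
inner-mirror {n} β μ x os 1≤x x<n inner
  with block-around μ x os 1≤x (≤-trans (n≤1+n x) x<n)
... | B@(1≤p , _ , q≤n , _ , q-bar , p<·≤q⇒𝚍) , p≤x , x≤q = record
  { s = s
  ; 1≤s = ≤-trans 1≤p (p≤p+q∸x p q (suc x) x<q)
  ; 1+s≤n = subst (_≤ n) (sym 1+s≡) (≤-trans (p+q∸x≤q p q x p≤x x≤q) q≤n)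
  ; inner-s = subst (λ t → μ ⟨ t ⟩ ≡ 𝚍) (sym 1+s≡)
      (p<·≤q⇒𝚍 _ (subst (p <_) 1+s≡ (s≤s (p≤p+q∸x p q (suc x) x<q))) (p+q∸x≤q p q x p≤x x≤q))
  ; rev-s = trans (rev-block β μ p q s B (p≤p+q∸x p q (suc x) x<q) (p+q∸x≤q p q (suc x) p≤1+x x<q))
                  (cong (β [_]) (p+q∸[p+q∸x]≡x p q (suc x) x<q))
  ; rev-1+s = trans (cong (rev β μ [_]) 1+s≡)
      (trans (rev-block β μ p q (p + q ∸ x) B (p≤p+q∸x p q x x≤q) (p+q∸x≤q p q x p≤x x≤q))
             (cong (β [_]) (p+q∸[p+q∸x]≡x p q x x≤q)))
  ; rev-x = trans (rev-block β μ p q x B p≤x x≤q) (cong (β [_]) (sym 1+s≡))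
  ; rev-1+x = rev-block β μ p q (suc x) B p≤1+x x<q
  }
  where
  p = bstart μ x
  q = bend μ x
  s = p + q ∸ suc x
  p≤1+x : p ≤ suc x
  p≤1+x = m≤n⇒m≤1+n p≤x
  x<q : suc x ≤ q
  x<q with m≤n⇒m<n∨m≡n x≤q
  ... | inj₁ x<q = x<q
  ... | inj₂ x≡q = ⊥-elim (𝚊≢𝚍 (trans (sym q-bar) (subst (λ t → μ ⟨ suc t ⟩ ≡ 𝚍) x≡q inner)))
  1+s≡ : suc s ≡ p + q ∸ x
  1+s≡ = suc[p+q∸suc[x]]≡p+q∸x p q x x<q

record IsPerm {n} (π : Perm n) : Set where
  field
    range : ∀ m → 1 ≤ m → m ≤ n → (1 ≤ π [ m ]) × (π [ m ] ≤ n)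
    injective : ∀ x y → 1 ≤ x → x ≤ n → 1 ≤ y → y ≤ n → π [ x ] ≡ π [ y ] → x ≡ y

idPerm-at : ∀ n m → 1 ≤ m → m ≤ n → idPerm n [ m ] ≡ m
idPerm-at n (suc i) _ m≤n = at-tabulate n 0 suc i m≤n

idPerm-isPerm : ∀ n → IsPerm (idPerm n)
idPerm-isPerm n = record
  { range = λ m 1≤m m≤n →
      subst (λ t → (1 ≤ t) × (t ≤ n)) (sym (idPerm-at n m 1≤m m≤n)) (1≤m , m≤n)
  ; injective = λ x y 1≤x x≤n 1≤y y≤n πx≡πy →
      trans (sym (idPerm-at n x 1≤x x≤n)) (trans πx≡πy (idPerm-at n y 1≤y y≤n))
  }

adjacent-distinct : ∀ {n} {π : Perm n} → IsPerm π → ∀ m → 1 ≤ m → suc m ≤ n → π [ m ] ≢ π [ suc m ]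
adjacent-distinct perm m 1≤m m<n eq =
  1+n≢n (sym (IsPerm.injective perm m (suc m) 1≤m (≤-trans (n≤1+n m) m<n) (s≤s z≤n) m<n eq))

permute-involution : ∀ {n} (π ρ : Perm n) (σ : ℕ → ℕ) → IsPerm π →
  (∀ x → 1 ≤ x → x ≤ n → (1 ≤ σ x) × (σ x ≤ n)) →
  (∀ x → 1 ≤ x → x ≤ n → σ (σ x) ≡ x) →
  (∀ x → 1 ≤ x → x ≤ n → ρ [ x ] ≡ π [ σ x ]) → IsPerm ρ
permute-involution {n} π ρ σ perm σ-range σσ≡id ρ≡πσ = record
  { range = λ m 1≤m m≤n → subst (λ t → (1 ≤ t) × (t ≤ n)) (sym (ρ≡πσ m 1≤m m≤n))
      (IsPerm.range perm (σ m) (proj₁ (σ-range m 1≤m m≤n)) (proj₂ (σ-range m 1≤m m≤n)))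
  ; injective = injective
  }
  where
  injective : ∀ x y → 1 ≤ x → x ≤ n → 1 ≤ y → y ≤ n → ρ [ x ] ≡ ρ [ y ] → x ≡ y
  injective x y 1≤x x≤n 1≤y y≤n ρx≡ρy = begin
    x         ≡⟨ sym (σσ≡id x 1≤x x≤n) ⟩
    σ (σ x)   ≡⟨ cong σ σx≡σy ⟩
    σ (σ y)   ≡⟨ σσ≡id y 1≤y y≤n ⟩
    y         ∎
    where
    open ≡-Reasoning
    σx≡σy : σ x ≡ σ y
    σx≡σy = IsPerm.injective perm (σ x) (σ y)
      (proj₁ (σ-range x 1≤x x≤n)) (proj₂ (σ-range x 1≤x x≤n))
      (proj₁ (σ-range y 1≤y y≤n)) (proj₂ (σ-range y 1≤y y≤n))
      (trans (sym (ρ≡πσ x 1≤x x≤n)) (trans ρx≡ρy (ρ≡πσ y 1≤y y≤n)))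

reflect-range : ∀ {n} (μ : Word n) → IsOpSeq μ → ∀ x → 1 ≤ x → x ≤ n →
  (1 ≤ reflect μ x) × (reflect μ x ≤ n)
reflect-range μ os x 1≤x x≤n with block-around μ x os 1≤x x≤n
... | (1≤p , _ , q≤n , _) , p≤x , x≤q =
  ≤-trans 1≤p (p≤p+q∸x _ _ x x≤q) , ≤-trans (p+q∸x≤q _ _ x p≤x x≤q) q≤n

reflect-involutive : ∀ {n} (μ : Word n) → IsOpSeq μ → ∀ x → 1 ≤ x → x ≤ n →
  reflect μ (reflect μ x) ≡ x
reflect-involutive μ os x 1≤x x≤n with block-around μ x os 1≤x x≤n
... | B , p≤x , x≤q =
  trans (reflect-block μ p q (p + q ∸ x) B (p≤p+q∸x p q x x≤q) (p+q∸x≤q p q x p≤x x≤q))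
        (p+q∸[p+q∸x]≡x p q x x≤q)
  where
  p = bstart μ x
  q = bend μ x

rev-isPerm : ∀ {n} (π : Perm n) (μ : Word n) → IsOpSeq μ → IsPerm π → IsPerm (rev π μ)
rev-isPerm π μ os perm =
  permute-involution π (rev π μ) (reflect μ) perm (reflect-range μ os) (reflect-involutive μ os)
    (rev-at π μ)

-- Agreement of a permutation with an operation sequence

Mismatch : ∀ {n} → Perm n → Word n → ℕ → Set
Mismatch π μ m = ((π [ m ] > π [ suc m ]) × (μ ⟨ suc m ⟩ ≡ 𝚊)) ⊎
                 ((π [ m ] < π [ suc m ]) × (μ ⟨ suc m ⟩ ≡ 𝚍))

Agrees : ∀ {n} → Perm n → Word n → Set
Agrees {n} π μ = ∀ m → 1 ≤ m → suc m ≤ n → ¬ Mismatch π μ m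

wLetter-< : ∀ {n} (π : Perm n) m → 1 ≤ m → suc m ≤ n → π [ m ] < π [ suc m ] →
  wLetter π (suc m) ≡ 𝚊
wLetter-< {n} π m 1≤m m<n asc with suc m ≟ 1 | suc m ≟ suc n
... | yes eq | _ = ⊥-elim (<⇒≢ (s≤s 1≤m) (sym eq))
... | no _ | yes eq = ⊥-elim (<⇒≢ m<n (suc-injective eq))
... | no _ | no _ with π [ m ] <? π [ suc m ]
...   | yes _ = refl
...   | no ≮ = ⊥-elim (≮ asc)

wLetter-≮ : ∀ {n} (π : Perm n) m → 1 ≤ m → suc m ≤ n → ¬ (π [ m ] < π [ suc m ]) →
  wLetter π (suc m) ≡ 𝚍
wLetter-≮ {n} π m 1≤m m<n ≮ with suc m ≟ 1 | suc m ≟ suc n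
... | yes eq | _ = ⊥-elim (<⇒≢ (s≤s 1≤m) (sym eq))
... | no _ | yes eq = ⊥-elim (<⇒≢ m<n (suc-injective eq))
... | no _ | no _ with π [ m ] <? π [ suc m ]
...   | yes asc = ⊥-elim (≮ asc)
...   | no _ = refl

wLetter-last : ∀ {n} (π : Perm n) → wLetter π (suc n) ≡ 𝚊
wLetter-last {n} π with suc n ≟ 1 | suc n ≟ suc n
... | yes _ | _ = refl
... | no _ | yes _ = refl
... | no _ | no ≢ = ⊥-elim (≢ refl)

w-at : ∀ {n} (π : Perm n) m → m ≤ n → w π ⟨ suc m ⟩ ≡ wLetter π (suc m)
w-at {n} π m m≤n = at-tabulate (suc n) 𝚊 (λ j → wLetter π (suc j)) m (s≤s m≤n)

w≡⇒agrees : ∀ {n} (π : Perm n) (μ : Word n) → w π ≡ μ → Agrees π μ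
w≡⇒agrees π μ refl m 1≤m m<n (inj₁ (desc , bar)) =
  𝚊≢𝚍 (trans (sym bar) (trans (w-at π m (≤-trans (n≤1+n m) m<n))
    (wLetter-≮ π m 1≤m m<n (<⇒≯ desc))))
w≡⇒agrees π μ refl m 1≤m m<n (inj₂ (asc , inner)) =
  𝚊≢𝚍 (trans (sym (wLetter-< π m 1≤m m<n asc))
    (trans (sym (w-at π m (≤-trans (n≤1+n m) m<n))) inner))

agrees⇒wLetter : ∀ {n} (π : Perm n) (μ : Word n) → IsPerm π → Agrees π μ →
  ∀ m → 1 ≤ m → suc m ≤ n → wLetter π (suc m) ≡ μ ⟨ suc m ⟩
agrees⇒wLetter π μ perm agree m 1≤m m<n with π [ m ] <? π [ suc m ] | μ ⟨ suc m ⟩ in eq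
... | yes asc | 𝚊 = wLetter-< π m 1≤m m<n asc
... | yes asc | 𝚍 = ⊥-elim (agree m 1≤m m<n (inj₂ (asc , eq)))
... | no ≮ | 𝚍 = wLetter-≮ π m 1≤m m<n ≮
... | no ≮ | 𝚊 = ⊥-elim (agree m 1≤m m<n (inj₁ (desc , eq)))
  where
  desc : π [ m ] > π [ suc m ]
  desc = ≤∧≢⇒< (≮⇒≥ ≮) (λ eq′ → adjacent-distinct perm m 1≤m m<n (sym eq′))

agrees⇒w≡ : ∀ {n} (π : Perm n) (μ : Word n) → IsPerm π → IsOpSeq μ → Agrees π μ → w π ≡ μ
agrees⇒w≡ {n} π μ perm (first , last) agree = at-ext (suc n) 𝚊 (w π) μ letters
  where
  letters : ∀ i → i < suc n → w π ⟨ suc i ⟩ ≡ μ ⟨ suc i ⟩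
  letters zero _ = trans (w-at π 0 z≤n) (sym first)
  letters (suc i) (s≤s i<n) with m≤n⇒m<n∨m≡n i<n
  ... | inj₁ 1+i<n =
    trans (w-at π (suc i) i<n) (agrees⇒wLetter π μ perm agree (suc i) (s≤s z≤n) 1+i<n)
  ... | inj₂ refl = trans (w-at π (suc i) i<n) (trans (wLetter-last π) (sym last))

agrees-bar⇒ascent : ∀ {n} (π : Perm n) (μ : Word n) → IsPerm π → Agrees π μ →
  ∀ m → 1 ≤ m → suc m ≤ n → μ ⟨ suc m ⟩ ≡ 𝚊 → π [ m ] < π [ suc m ]
agrees-bar⇒ascent π μ perm agree m 1≤m m<n bar with <-cmp (π [ m ]) (π [ suc m ])
... | tri< asc _ _ = asc
... | tri≈ _ eq _ = ⊥-elim (adjacent-distinct perm m 1≤m m<n eq)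
... | tri> _ _ desc = ⊥-elim (agree m 1≤m m<n (inj₁ (desc , bar)))

agrees-inner⇒descent : ∀ {n} (π : Perm n) (μ : Word n) → IsPerm π → Agrees π μ →
  ∀ m → 1 ≤ m → suc m ≤ n → μ ⟨ suc m ⟩ ≡ 𝚍 → π [ suc m ] < π [ m ]
agrees-inner⇒descent π μ perm agree m 1≤m m<n inner with <-cmp (π [ m ]) (π [ suc m ])
... | tri< asc _ _ = ⊥-elim (agree m 1≤m m<n (inj₂ (asc , inner)))
... | tri≈ _ eq _ = ⊥-elim (adjacent-distinct perm m 1≤m m<n eq)
... | tri> _ _ desc = desc

-- One reversal step α = rev(β, μ)

-- F1 M and F2 M are F1At and F2At for β = α₂ and μ = μ₁.
F1At : ∀ {n} → Perm n → Word n → ℕ → ℕ → Set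
F1At {n} β μ a b = ∃ λ m → (1 ≤ m) × (suc m ≤ n) × AdjAt β a b m ×
  (β [ m ] > β [ suc m ]) × (μ ⟨ suc m ⟩ ≡ 𝚍)

F2At : ∀ {n} → Perm n → Word n → ℕ → ℕ → Set
F2At {n} β μ a b = ∃ λ p → ∃ λ q → (1 ≤ p) × (p < q) × (q ≤ n) ×
  (β [ p ] ≡ a ⊔ b) × (β [ q ] ≡ a ⊓ b) ×
  (μ ⟨ p ⟩ ≡ 𝚊) × (μ ⟨ suc q ⟩ ≡ 𝚊) ×
  (∃ λ m → (p < m) × (m ≤ q) × (μ ⟨ m ⟩ ≡ 𝚊) ×
     (∀ m′ → p < m′ → m′ ≤ q → μ ⟨ m′ ⟩ ≡ 𝚊 → m′ ≡ m))

adjacent-blocks⇒F2At : ∀ {n} (β : Perm n) (μ : Word n) a b p m q →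
  IsBlock μ p m → IsBlock μ (suc m) q → β [ p ] ≡ a ⊔ b → β [ q ] ≡ a ⊓ b → F2At β μ a b
adjacent-blocks⇒F2At β μ a b p m q
  (1≤p , p≤m , _ , p-bar , m-bar , inner₁) (_ , m<q , q≤n , _ , q-bar , inner₂) βp βq =
  p , q , 1≤p , <-≤-trans (s≤s p≤m) m<q , q≤n , βp , βq , p-bar , q-bar ,
  (suc m , s≤s p≤m , m<q , m-bar , only-bar)
  where
  only-bar : ∀ x → p < x → x ≤ q → μ ⟨ x ⟩ ≡ 𝚊 → x ≡ suc m
  only-bar x p<x x≤q bar with <-cmp x (suc m)
  ... | tri< x≤m _ _ = ⊥-elim (𝚊≢𝚍 (trans (sym bar) (inner₁ x p<x (≤-pred x≤m))))
  ... | tri≈ _ x≡1+m _ = x≡1+m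
  ... | tri> _ _ m<x = ⊥-elim (𝚊≢𝚍 (trans (sym bar) (inner₂ x m<x x≤q)))

F2At⇒adjacent-blocks : ∀ {n} (β : Perm n) (μ : Word n) a b → F2At β μ a b →
  ∃ λ p → ∃ λ m → ∃ λ q → IsBlock μ p m × IsBlock μ (suc m) q ×
    (β [ p ] ≡ a ⊔ b) × (β [ q ] ≡ a ⊓ b)
F2At⇒adjacent-blocks β μ a b
  (p , q , 1≤p , _ , q≤n , βp , βq , p-bar , q-bar , suc m , s≤s p≤m , m<q , m-bar , only-bar) =
  p , m , q ,
  (1≤p , p≤m , ≤-trans (n≤1+n m) (≤-trans m<q q≤n) , p-bar , m-bar , inner₁) ,
  (s≤s z≤n , m<q , q≤n , m-bar , q-bar , inner₂) , βp , βq
  where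
  inner₁ : ∀ x → p < x → x ≤ m → μ ⟨ x ⟩ ≡ 𝚍
  inner₁ x p<x x≤m = ≢𝚊⇒≡𝚍 λ bar →
    1+n≰n (subst (_≤ m) (only-bar x p<x (≤-trans x≤m (≤-trans (n≤1+n m) m<q)) bar) x≤m)
  inner₂ : ∀ x → suc m < x → x ≤ q → μ ⟨ x ⟩ ≡ 𝚍
  inner₂ x m<x x≤q = ≢𝚊⇒≡𝚍 λ bar →
    <-irrefl (sym (only-bar x (<-trans (s≤s p≤m) m<x) x≤q bar)) m<x

agrees-rev⇒descent-at-bar : ∀ {n} (β : Perm n) (μ : Word n) → IsOpSeq μ → Agrees (rev β μ) μ →
  ∀ x → 1 ≤ x → suc x ≤ n → β [ suc x ] < β [ x ] → μ ⟨ suc x ⟩ ≡ 𝚊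
agrees-rev⇒descent-at-bar β μ os agree x 1≤x x<n desc = ≢𝚍⇒≡𝚊 λ inner →
  let open InnerMirror (inner-mirror β μ x os 1≤x x<n inner)
  in agree s 1≤s 1+s≤n (inj₂ (subst₂ _<_ (sym rev-s) (sym rev-1+s) desc , inner-s))

agrees-rev⇒¬F1At : ∀ {n} (α β : Perm n) (μ : Word n) → α ≡ rev β μ → IsOpSeq μ → Agrees α μ →
  ∀ a b → ¬ F1At β μ a b
agrees-rev⇒¬F1At .(rev β μ) β μ refl os agree a b (m , 1≤m , m<n , _ , desc , inner) =
  𝚊≢𝚍 (trans (sym (agrees-rev⇒descent-at-bar β μ os agree m 1≤m m<n desc)) inner)

agrees-rev⇒¬F2At : ∀ {n} (α β : Perm n) (μ : Word n) → α ≡ rev β μ → IsPerm α → Agrees α μ →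
  ∀ a b → ¬ F2At β μ a b
agrees-rev⇒¬F2At .(rev β μ) β μ refl perm agree a b f2
  with F2At⇒adjacent-blocks β μ a b f2
... | p , m , q , B₁@(1≤p , p≤m , _) , B₂@(_ , m<q , q≤n , m-bar , _) , βp , βq =
  <⇒≱ max<min (m⊓n≤m⊔n a b)
  where
  ascent : rev β μ [ m ] < rev β μ [ suc m ]
  ascent = agrees-bar⇒ascent (rev β μ) μ perm agree m (≤-trans 1≤p p≤m)
    (≤-trans m<q q≤n) m-bar
  max<min : a ⊔ b < a ⊓ b
  max<min = subst₂ _<_ (trans (rev-block-end β μ p m B₁) βp)
                       (trans (rev-block-start β μ (suc m) q B₂) βq) ascent

rev-mismatch⇒F1At⊎F2At : ∀ {n} (α β : Perm n) (μ : Word n) → α ≡ rev β μ → IsOpSeq μ →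
  ∀ m → 1 ≤ m → suc m ≤ n → Mismatch α μ m →
  F1At β μ (α [ m ]) (α [ suc m ]) ⊎ F2At β μ (α [ m ]) (α [ suc m ])
rev-mismatch⇒F1At⊎F2At .(rev β μ) β μ refl os m 1≤m m<n (inj₁ (desc , bar))
  with block-ending-at μ m os 1≤m (≤-trans (n≤1+n m) m<n) bar
     | block-starting-at μ (suc m) os (s≤s z≤n) m<n bar
... | p , B₁ | q , B₂ = inj₂ (adjacent-blocks⇒F2At β μ _ _ p m q B₁ B₂
  (trans (sym (rev-block-end β μ p m B₁)) (sym (m≥n⇒m⊔n≡m (<⇒≤ desc))))
  (trans (sym (rev-block-start β μ (suc m) q B₂)) (sym (m≥n⇒m⊓n≡n (<⇒≤ desc)))))
rev-mismatch⇒F1At⊎F2At .(rev β μ) β μ refl os m 1≤m m<n (inj₂ (asc , inner)) =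
  inj₁ (s , 1≤s , 1+s≤n , inj₂ (sym rev-1+x , sym rev-x) ,
        subst₂ _>_ rev-1+x rev-x asc , inner-s)
  where open InnerMirror (inner-mirror β μ m os 1≤m m<n inner)

-- If β agrees with μ, three 𝚍's of μ give three consecutive descents of β; the next reversal
-- needs a bar at each of them, so it fixes the middle pair while requiring it to ascend.
agrees-rev⇒¬DDD : ∀ {n} (α β : Perm n) (μ ν : Word n) → α ≡ rev β ν →
  IsPerm β → IsOpSeq μ → IsOpSeq ν → Agrees β μ → Agrees α ν → ¬ DDDin μ 1 (suc n)
agrees-rev⇒¬DDD _ _ _ _ _ _ _ _ _ _ (zero , () , _)
agrees-rev⇒¬DDD _ _ _ _ _ _ (first , _) _ _ _ (suc zero , _ , _ , inner , _) =
  𝚊≢𝚍 (trans (sym first) inner)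
agrees-rev⇒¬DDD {n} .(rev β ν) β μ ν refl β-perm (_ , last) os-ν agree-β agree-α
  (suc (suc x′) , _ , 3+x≤1+n , inner₁ , inner₂ , inner₃) =
  agree-α (suc x) (s≤s z≤n) 2+x≤n (inj₁ (subst₂ _>_ (sym fixed₁) (sym fixed₂) desc₂ , bar₂))
  where
  x = suc x′
  3+x≤n : suc (suc (suc x)) ≤ n
  3+x≤n with m≤n⇒m<n∨m≡n (subst (_≤ suc n) (+-comm (suc x) 2) 3+x≤1+n)
  ... | inj₁ lt = ≤-pred lt
  ... | inj₂ eq = ⊥-elim (𝚊≢𝚍 (trans (sym last) (trans (cong (μ ⟨_⟩) (sym eq)) inner₃)))
  2+x≤n = ≤-trans (n≤1+n _) 3+x≤n
  1+x≤n = ≤-trans (n≤1+n _) 2+x≤n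
  desc : ∀ y → 1 ≤ y → suc y ≤ n → μ ⟨ suc y ⟩ ≡ 𝚍 → β [ suc y ] < β [ y ]
  desc = agrees-inner⇒descent β μ β-perm agree-β
  bar : ∀ y → 1 ≤ y → suc y ≤ n → μ ⟨ suc y ⟩ ≡ 𝚍 → ν ⟨ suc y ⟩ ≡ 𝚊
  bar y 1≤y y<n inner = agrees-rev⇒descent-at-bar β ν os-ν agree-α y 1≤y y<n (desc y 1≤y y<n inner)
  bar₁ = bar x (s≤s z≤n) 1+x≤n inner₁
  bar₂ = bar (suc x) (s≤s z≤n) 2+x≤n inner₂
  bar₃ = bar (suc (suc x)) (s≤s z≤n) 3+x≤n inner₃
  desc₂ = desc (suc x) (s≤s z≤n) 2+x≤n inner₂
  fixed₁ = rev-block-start β ν (suc x) (suc x)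
    (singleton-block ν (suc x) (s≤s z≤n) 1+x≤n bar₁ bar₂)
  fixed₂ = rev-block-start β ν (suc (suc x)) (suc (suc x))
    (singleton-block ν (suc (suc x)) (s≤s z≤n) 2+x≤n bar₂ bar₃)

-- The semitrace

semitraceV-∷ : ∀ {k n} (μ : Word n) (M : OpArray k n) →
  semitraceV (μ ∷ M) ≡ rev (head (semitraceV M)) μ ∷ semitraceV M
semitraceV-∷ μ M with semitraceV M
... | α ∷ T = refl

alpha-∷-1 : ∀ {k n} (μ : Word n) (M : OpArray k n) → alpha (μ ∷ M) 1 ≡ rev (alpha M 1) μ
alpha-∷-1 μ M rewrite semitraceV-∷ μ M with semitraceV M
... | α ∷ T = refl

alpha-∷-suc : ∀ {k n} (μ : Word n) (M : OpArray k n) i →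
  alpha (μ ∷ M) (suc (suc i)) ≡ alpha M (suc i)
alpha-∷-suc μ M i rewrite semitraceV-∷ μ M = refl

alpha-step : ∀ {k n} (M : OpArray k n) i → 1 ≤ i → i ≤ k → alpha M i ≡ rev (alpha M (suc i)) (row M i)
alpha-step (μ ∷ M) (suc zero) _ _ =
  trans (alpha-∷-1 μ M) (cong (λ α → rev α μ) (sym (alpha-∷-suc μ M 0)))
alpha-step (μ ∷ M) (suc (suc i)) _ (s≤s i<k) =
  trans (alpha-∷-suc μ M i) (trans (alpha-step M (suc i) (s≤s z≤n) i<k)
    (cong (λ α → rev α (row M (suc i))) (sym (alpha-∷-suc μ M (suc i)))))

row-isOpSeq : ∀ {k n} (M : OpArray k n) → IsOpArray M → ∀ i → 1 ≤ i → i ≤ k → IsOpSeq (row M i)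
row-isOpSeq (μ ∷ M) (os ∷ _) (suc zero) _ _ = os
row-isOpSeq (μ ∷ M) (_ ∷ oss) (suc (suc i)) _ (s≤s i<k) = row-isOpSeq M oss (suc i) (s≤s z≤n) i<k

-- Out-of-range indices return the default identity, which is also a permutation.
alpha-isPerm : ∀ {k n} (M : OpArray k n) → IsOpArray M → ∀ i → IsPerm (alpha M i)
alpha-isPerm {n = n} [] _ zero = idPerm-isPerm n
alpha-isPerm {n = n} [] _ (suc zero) = idPerm-isPerm n
alpha-isPerm {n = n} [] _ (suc (suc i)) = idPerm-isPerm n
alpha-isPerm {n = n} (μ ∷ M) _ zero = idPerm-isPerm n
alpha-isPerm (μ ∷ M) (os ∷ oss) (suc zero) =
  subst IsPerm (sym (alpha-∷-1 μ M)) (rev-isPerm _ μ os (alpha-isPerm M oss 1))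
alpha-isPerm (μ ∷ M) (_ ∷ oss) (suc (suc i)) =
  subst IsPerm (sym (alpha-∷-suc μ M i)) (alpha-isPerm M oss (suc i))

module _ {k n : ℕ} (M : OpArray k n) (hM : IsOpArray M) where

  RowsAgree : Set
  RowsAgree = ∀ i → 1 ≤ i → i ≤ k → Agrees (alpha M i) (row M i)

  sortingPlan⇔rowsAgree : SortingPlan M ⇔ RowsAgree
  sortingPlan⇔rowsAgree = mk⇔
    (λ plan i 1≤i i≤k → w≡⇒agrees (alpha M i) (row M i) (plan i 1≤i i≤k))
    (λ agree i 1≤i i≤k → agrees⇒w≡ (alpha M i) (row M i) (alpha-isPerm M hM i)
      (row-isOpSeq M hM i 1≤i i≤k) (agree i 1≤i i≤k))

  rowsAgree⇒noBoundedForbidden : 1 ≤ k → RowsAgree → NoBoundedForbidden M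
  rowsAgree⇒noBoundedForbidden _ agree
    (_ , _ , _ , _ , _ , _ , _ , _ , inj₁ (i , 2≤i , i≤k , m , 1≤m , m<n , _ , mismatch)) =
    agree i (≤-trans (s≤s z≤n) 2≤i) i≤k m 1≤m m<n mismatch
  rowsAgree⇒noBoundedForbidden 1≤k agree (a , b , _ , _ , _ , _ , _ , _ , inj₂ (inj₁ f1)) =
    agrees-rev⇒¬F1At (alpha M 1) (alpha M 2) (row M 1) (alpha-step M 1 ≤-refl 1≤k)
      (row-isOpSeq M hM 1 ≤-refl 1≤k) (agree 1 ≤-refl 1≤k) a b f1
  rowsAgree⇒noBoundedForbidden 1≤k agree (a , b , _ , _ , _ , _ , _ , _ , inj₂ (inj₂ f2)) =
    agrees-rev⇒¬F2At (alpha M 1) (alpha M 2) (row M 1) (alpha-step M 1 ≤-refl 1≤k)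
      (alpha-isPerm M hM 1) (agree 1 ≤-refl 1≤k) a b f2

  rowsAgree⇒noDDDRows : RowsAgree → NoDDDRows M
  rowsAgree⇒noDDDRows agree (suc r) (s≤s 1≤r) r<k =
    agrees-rev⇒¬DDD (alpha M r) (alpha M (suc r)) (row M (suc r)) (row M r)
      (alpha-step M r 1≤r r≤k) (alpha-isPerm M hM (suc r))
      (row-isOpSeq M hM (suc r) (s≤s z≤n) r<k) (row-isOpSeq M hM r 1≤r r≤k)
      (agree (suc r) (s≤s z≤n) r<k) (agree r 1≤r r≤k)
    where
    r≤k = ≤-trans (n≤1+n r) r<k

  noDDDRows⇒bounded : NoDDDRows M → ∀ a b → Bounded M a b
  noDDDRows⇒bounded noDDD a b i j ((1≤i , _ , j≤1+n) , _) r 2≤r r≤k (m , i≤m , m+2≤j , ddd) =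
    noDDD r 2≤r r≤k (m , ≤-trans 1≤i i≤m , ≤-trans m+2≤j j≤1+n , ddd)

  -- A mismatch of row i at positions m, m+1 makes the pair of values there forbidden.
  noBoundedForbidden⇒rowsAgree : NoBoundedForbidden M → NoDDDRows M → RowsAgree
  noBoundedForbidden⇒rowsAgree noBF noDDD i 1≤i i≤k m 1≤m m<n mismatch =
    noBF (α [ m ] , α [ suc m ] , 1≤αm , αm≤n , 1≤αm′ , αm′≤n ,
          adjacent-distinct α-perm m 1≤m m<n , noDDDRows⇒bounded noDDD _ _ ,
          forbidden i 1≤i i≤k mismatch)
    where
    α = alpha M i
    α-perm = alpha-isPerm M hM i
    1≤αm = proj₁ (IsPerm.range α-perm m 1≤m (≤-trans (n≤1+n m) m<n))
    αm≤n = proj₂ (IsPerm.range α-perm m 1≤m (≤-trans (n≤1+n m) m<n))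
    1≤αm′ = proj₁ (IsPerm.range α-perm (suc m) (s≤s z≤n) m<n)
    αm′≤n = proj₂ (IsPerm.range α-perm (suc m) (s≤s z≤n) m<n)
    forbidden : ∀ i → 1 ≤ i → i ≤ k → Mismatch (alpha M i) (row M i) m →
      Forbidden M (alpha M i [ m ]) (alpha M i [ suc m ])
    forbidden (suc zero) 1≤i i≤k mismatch =
      inj₂ (rev-mismatch⇒F1At⊎F2At (alpha M 1) (alpha M 2) (row M 1) (alpha-step M 1 1≤i i≤k)
        (row-isOpSeq M hM 1 1≤i i≤k) m 1≤m m<n mismatch)
    forbidden (suc (suc i)) _ i≤k mismatch =
      inj₁ (suc (suc i) , s≤s (s≤s z≤n) , i≤k , m , 1≤m , m<n , inj₁ (refl , refl) , mismatch)

proposition1 : ∀ (k n : ℕ) (M : OpArray k n) → 1 ≤ k → IsOpArray M →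
    SortingPlan M ⇔ (NoBoundedForbidden M × NoDDDRows M)
proposition1 k n M 1≤k hM = mk⇔
  (λ plan → let agree = to plan in
    rowsAgree⇒noBoundedForbidden M hM 1≤k agree , rowsAgree⇒noDDDRows M hM agree)
  (λ (noBF , noDDD) → from (noBoundedForbidden⇒rowsAgree M hM noBF noDDD))
  where open Equivalence (sortingPlan⇔rowsAgree M hM)
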